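{- Let $\rho(\Delta)$ be defined, for integers $\Delta\ge1$, by \[ \frac{1}{\rho(\Delta)} = \min_{0 < x \le 1}\left( \frac{x^2}{\Delta + x} + \frac{1}{x\Delta + 1}\right). \] Then $\displaystyle \lim_{\Delta\to\infty} \frac{\rho(\Delta)}{\Delta+1} = \frac{2^{2/3}}{3} \approx 0.529$; i.e., the asymptotic performance ratio of MaxAlg is $2^{2/3}(\Delta+1)/3$.
   Context: $\rho(\Delta)$ is the exact performance ratio of the following algorithm MaxAlg for maximum weight independent set on graphs of maximum degree $\Delta$ with positive integer vertex weights $w$: each node $v$ picks $x_v$ uniformly from $[0,1]$, sets $r_v = x_v^{1/w(v)}$, and joins the solution iff $r_v$ exceeds $r_u$ for all neighbors $u$. -}

module Defs where

open import Data.Nat using (ℕ)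
open import Data.Rational
  using (ℚ; 0ℚ; 1ℚ; _+_; _*_; _<_; _≤_; 1/_; positive; Positive; NonNegative)
  renaming (_/_ to _÷ℤ_)
open import Data.Rational.Properties
  using (pos⇒nonZero; +-mono-≤-<; <-≤-trans; ≤-refl; *-monoʳ-≤-nonNeg; *-zeroˡ; <⇒≤; positive⁻¹; nonNegative⁻¹)
open import Data.Integer using (+_)
open import Relation.Binary.PropositionalEquality using (subst; sym)

ℕ→ℚ : ℕ → ℚ
ℕ→ℚ n = (+ n) ÷ℤ 1

inv : (q : ℚ) → 0ℚ < q → ℚ
inv q h = 1/_ q {{pos⇒nonZero q {{positive h}}}}

private
  0≤ℕ : (n : ℕ) → 0ℚ ≤ ℕ→ℚ n
  0≤ℕ n = nonNegative⁻¹ (ℕ→ℚ n) {{Data.Rational.Properties.normalize-nonNeg n 1}}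

  0≤x*n : (x : ℚ) → 0ℚ < x → (n : ℕ) → 0ℚ ≤ x * ℕ→ℚ n
  0≤x*n x h n =
    subst (_≤ x * ℕ→ℚ n) (*-zeroˡ (ℕ→ℚ n))
      (*-monoʳ-≤-nonNeg (ℕ→ℚ n) {{Data.Rational.Properties.normalize-nonNeg n 1}} (<⇒≤ h))

  posΔ+x : (Δ : ℕ) (x : ℚ) → 0ℚ < x → 0ℚ < ℕ→ℚ Δ + x
  posΔ+x Δ x h = subst (_< ℕ→ℚ Δ + x) (Data.Rational.Properties.+-identityʳ 0ℚ)
                   (+-mono-≤-< (0≤ℕ Δ) h)

  posxΔ+1 : (Δ : ℕ) (x : ℚ) → 0ℚ < x → 0ℚ < x * ℕ→ℚ Δ + 1ℚ
  posxΔ+1 Δ x h = subst (_< x * ℕ→ℚ Δ + 1ℚ) (Data.Rational.Properties.+-identityʳ 0ℚ)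
                   (+-mono-≤-< (0≤x*n x h Δ) (positive⁻¹ 1ℚ))

-- The objective  x²/(Δ + x) + 1/(xΔ + 1)  for 0 < x, so that
--   1/ρ(Δ) = min_{0<x≤1} objective Δ x.
objective : (Δ : ℕ) (x : ℚ) → 0ℚ < x → ℚ
objective Δ x h = x * x * inv (ℕ→ℚ Δ + x) (posΔ+x Δ x h) + inv (x * ℕ→ℚ Δ + 1ℚ) (posxΔ+1 Δ x h)

open import Data.Product using (Σ; _×_; ∃-syntax)
open import Data.Sum using (_⊎_)

-- The limit constant c = 2^(2/3)/3 is irrational; it is characterised by
-- c > 0 and c³ = 4/27.  For a rational p:  p < c  iff  p ≤ 0 or 27p³ < 4.
BelowLimitConst : ℚ → Set
BelowLimitConst p = p ≤ 0ℚ ⊎ (0ℚ < p × ℕ→ℚ 27 * (p * p * p) < ℕ→ℚ 4)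

-- For a rational q:  c < q  iff  q > 0 and 4 < 27q³.
AboveLimitConst : ℚ → Set
AboveLimitConst q = 0ℚ < q × ℕ→ℚ 4 < ℕ→ℚ 27 * (q * q * q)

-- "p < ρ(Δ)/(Δ+1)", where 1/ρ(Δ) = min_{0<x≤1} objective Δ x.
-- Equivalently p·(Δ+1)·(1/ρ(Δ)) < 1, i.e. some x ∈ (0,1] has
-- p·(Δ+1)·objective Δ x < 1 (by continuity and density, x may be taken rational).
RatioAbove : ℕ → ℚ → Set
RatioAbove Δ p =
  ∃[ x ] Σ (0ℚ < x) λ h → x ≤ 1ℚ × p * (ℕ→ℚ Δ + 1ℚ) * objective Δ x h < 1ℚ

-- "ρ(Δ)/(Δ+1) < q".  Equivalently (Δ+1)·(1/ρ(Δ)) > 1/q, i.e. there is a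
-- rational r < q with r·(Δ+1)·objective Δ x ≥ 1 for all x ∈ (0,1]
-- (again rational x suffice by continuity).
RatioBelow : ℕ → ℚ → Set
RatioBelow Δ q =
  ∃[ r ] (r < q × ((x : ℚ) (h : 0ℚ < x) → x ≤ 1ℚ → 1ℚ ≤ r * (ℕ→ℚ Δ + 1ℚ) * objective Δ x h))

{-# OPTIONS --safe #-}
-- Write D = Δ and y = (xD + 1)/(D + 1).  Then
--   (D + 1) · objective x = x²(D + 1)/(D + x) + 1/y,
-- and for x ∈ (0, 1] the first term lies between x² and x² + 1/(D + x), while x ≤ y and
-- y² ≤ x² + 1/(D + 1).  So (D + 1) · objective is x² + 1/x up to O(1/D), and the limit
-- function y² + 1/y has minimum 1/c = 3/∛4 by AM-GM, in the cube-free form 27t ≤ 4(t + 1)³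
-- for t = y³.  For p < c the point x = 3p/2 gives p (x² + 1/x) = 9p³/4 + 2/3 < 1; for
-- q > c one picks a rational m with 1/q < m ≤ 1/c and bounds (D + 1) · objective below by
-- m - 1/(D + 1) everywhere on (0, 1].
module Submission where

open import Defs
open import Data.Rational using (ℚ)
open import Data.Product using (_×_; ∃-syntax; _,_; proj₁; proj₂)

-- Kept in a module of its own so that _≤_ and _<_ are the orders of ℚ here but of ℕ in
-- mainTheorem7.
module RatioAsymptotics where
  open import Data.Nat as ℕ using (ℕ; suc)
  import Data.Nat.Properties as ℕ
  open import Data.Integer as ℤ using (+_; -[1+_])
  import Data.Integer.Properties as ℤ
  import Data.Nat.Coprimality as Coprime
  open import Data.Rational
    using (mkℚ; 0ℚ; 1ℚ; ½; _+_; _*_; _-_; -_; _/_; _≤_; _<_; *≤*; *<*; positive; nonNegative; nonPositive)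
  open import Data.Rational.Properties
    using ( ≤-refl; ≤-trans; ≤-total; <⇒≤; <-trans; <-≤-trans; ≤-<-trans; <-irrefl; ≮⇒≥
          ; normalize-coprime; module ≤-Reasoning
          ; +-identityʳ; +-inverseʳ; +-comm; +-mono-≤; +-mono-<-≤; +-mono-≤-<
          ; +-monoˡ-≤; +-monoʳ-≤; +-monoˡ-<; +-monoʳ-<
          ; *-identityˡ; *-identityʳ; *-assoc; *-comm; *-distribˡ-+; *-inverseˡ; *-inverseʳ
          ; *-monoˡ-≤-nonNeg; *-monoʳ-≤-nonNeg; *-monoˡ-<-pos; *-monoʳ-<-pos
          ; *-cancelˡ-≤-pos; *-cancelʳ-<-nonNeg
          ; nonNeg*nonNeg⇒nonNeg; pos*pos⇒pos; nonPos*nonPos⇒nonPos; nonPos*nonNeg⇒nonPos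
          ; pos⇒nonZero; 1/pos⇒pos; positive⁻¹; nonNegative⁻¹; nonPositive⁻¹)
  open import Data.Rational.Solver using (module +-*-Solver)
  open import Data.Sum using (inj₁; inj₂)
  open import Relation.Binary.PropositionalEquality using (_≡_; refl; sym; trans; cong; subst; subst₂)
  open +-*-Solver using (solve; _:=_; _:+_; _:*_; _:-_; :-_; con)

  infix 8 _³
  _³ : ℚ → ℚ
  p ³ = p * p * p

  0<1 : 0ℚ < 1ℚ
  0<1 = positive⁻¹ 1ℚ

  0≤p*q : ∀ {p q} → 0ℚ ≤ p → 0ℚ ≤ q → 0ℚ ≤ p * q
  0≤p*q {p} {q} 0≤p 0≤q =
    nonNegative⁻¹ _ {{nonNeg*nonNeg⇒nonNeg p {{nonNegative 0≤p}} q {{nonNegative 0≤q}}}}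

  0<p*q : ∀ {p q} → 0ℚ < p → 0ℚ < q → 0ℚ < p * q
  0<p*q {p} {q} 0<p 0<q = positive⁻¹ _ {{pos*pos⇒pos p {{positive 0<p}} q {{positive 0<q}}}}

  0≤p*p : ∀ p → 0ℚ ≤ p * p
  0≤p*p p with ≤-total 0ℚ p
  ... | inj₁ 0≤p = 0≤p*q 0≤p 0≤p
  -- Despite its name, nonPos*nonPos⇒nonPos concludes NonNegative.
  ... | inj₂ p≤0 = nonNegative⁻¹ _ {{nonPos*nonPos⇒nonPos p {{nonPositive p≤0}} p {{nonPositive p≤0}}}}

  0≤p+q : ∀ {p q} → 0ℚ ≤ p → 0ℚ ≤ q → 0ℚ ≤ p + q
  0≤p+q 0≤p 0≤q = +-mono-≤ 0≤p 0≤q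

  0<p+q : ∀ {p q} → 0ℚ ≤ p → 0ℚ < q → 0ℚ < p + q
  0<p+q 0≤p 0<q = +-mono-≤-< 0≤p 0<q

  0<p+q′ : ∀ {p q} → 0ℚ < p → 0ℚ ≤ q → 0ℚ < p + q
  0<p+q′ 0<p 0≤q = +-mono-<-≤ 0<p 0≤q

  p≤q⇒0≤q-p : ∀ {p q} → p ≤ q → 0ℚ ≤ q - p
  p≤q⇒0≤q-p {p} {q} p≤q = subst (_≤ q - p) (+-inverseʳ p) (+-monoˡ-≤ (- p) p≤q)

  p<q⇒0<q-p : ∀ {p q} → p < q → 0ℚ < q - p
  p<q⇒0<q-p {p} {q} p<q = subst (_< q - p) (+-inverseʳ p) (+-monoˡ-< (- p) p<q)

  ≤-by-gap : ∀ {p q} d → 0ℚ ≤ d → p + d ≡ q → p ≤ q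
  ≤-by-gap {p} d 0≤d p+d≡q = subst₂ _≤_ (+-identityʳ p) p+d≡q (+-monoʳ-≤ p 0≤d)

  <-by-gap : ∀ {p q} d → 0ℚ < d → p + d ≡ q → p < q
  <-by-gap {p} d 0<d p+d≡q = subst₂ _<_ (+-identityʳ p) p+d≡q (+-monoʳ-< p 0<d)

  -- The ring solver cannot use hypotheses: an equation F ≡ G enters an identity through a
  -- multiple of F - G.
  ≡-modulo : ∀ {p q F G} c → F ≡ G → p ≡ q + c * (F - G) → p ≡ q
  ≡-modulo {q = q} {G = G} c refl p≡ = trans p≡
    (solve 3 (λ q c G → q :+ c :* (G :- G) := q) refl q c G)

  inv-pos : ∀ q (h : 0ℚ < q) → 0ℚ < inv q h
  inv-pos q h = positive⁻¹ _ {{1/pos⇒pos q {{positive h}}}}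

  inv-inverseˡ : ∀ q (h : 0ℚ < q) → inv q h * q ≡ 1ℚ
  inv-inverseˡ q h = *-inverseˡ q {{pos⇒nonZero q {{positive h}}}}

  inv-inverseʳ : ∀ q (h : 0ℚ < q) → q * inv q h ≡ 1ℚ
  inv-inverseʳ q h = *-inverseʳ q {{pos⇒nonZero q {{positive h}}}}

  inv-cancelʳ : ∀ p q (h : 0ℚ < q) → p * q * inv q h ≡ p
  inv-cancelʳ p q h = trans (*-assoc p q _) (trans (cong (p *_) (inv-inverseʳ q h)) (*-identityʳ p))

  inv-cancelˡ : ∀ p q (h : 0ℚ < q) → p * inv q h * q ≡ p
  inv-cancelˡ p q h = trans (*-assoc p _ q) (trans (cong (p *_) (inv-inverseˡ q h)) (*-identityʳ p))

  <-*inv : ∀ {a b q} (h : 0ℚ < q) → a < b * q → a * inv q h < b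
  <-*inv {a} {b} {q} h a<bq = subst (a * inv q h <_) (inv-cancelʳ b q h)
    (*-monoˡ-<-pos (inv q h) {{positive (inv-pos q h)}} a<bq)

  inv≤1 : ∀ {q} (h : 0ℚ < q) → 1ℚ ≤ q → inv q h ≤ 1ℚ
  inv≤1 {q} h 1≤q = subst₂ _≤_ (*-identityˡ (inv q h)) (inv-inverseʳ q h)
    (*-monoʳ-≤-nonNeg (inv q h) {{nonNegative (<⇒≤ (inv-pos q h))}} 1≤q)

  cube-mono-< : ∀ {p q} → 0ℚ ≤ p → p < q → p ³ < q ³
  cube-mono-< {p} {q} 0≤p p<q = <-by-gap ((q - p) * (q * q + q * p + p * p)) 0<gap
    (solve 2 (λ p q → p :* p :* p :+ (q :- p) :* (q :* q :+ q :* p :+ p :* p) := q :* q :* q) refl p q)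
    where
    0<q : 0ℚ < q
    0<q = ≤-<-trans 0≤p p<q
    0<gap : 0ℚ < (q - p) * (q * q + q * p + p * p)
    0<gap = 0<p*q (p<q⇒0<q-p p<q) (0<p+q′ (0<p+q′ (0<p*q 0<q 0<q) (0≤p*q (<⇒≤ 0<q) 0≤p)) (0≤p*p p))

  cube-cancel-≤ : ∀ {p q} → 0ℚ ≤ q → p ³ ≤ q ³ → p ≤ q
  cube-cancel-≤ 0≤q p³≤q³ = ≮⇒≥ (λ q<p → <-irrefl refl (<-≤-trans (cube-mono-< 0≤q q<p) p³≤q³))

  ℕ→ℚ≡mkℚ : ∀ n → ℕ→ℚ n ≡ mkℚ (+ n) 0 (Coprime.sym (Coprime.1-coprimeTo n))
  ℕ→ℚ≡mkℚ n = normalize-coprime (Coprime.sym (Coprime.1-coprimeTo n))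

  ℕ→ℚ-mono-≤ : ∀ {m n} → m ℕ.≤ n → ℕ→ℚ m ≤ ℕ→ℚ n
  ℕ→ℚ-mono-≤ {m} {n} m≤n rewrite ℕ→ℚ≡mkℚ m | ℕ→ℚ≡mkℚ n =
    *≤* (subst₂ ℤ._≤_ (sym (ℤ.*-identityʳ (+ m))) (sym (ℤ.*-identityʳ (+ n))) (ℤ.+≤+ m≤n))

  0≤ℕ→ℚ : ∀ n → 0ℚ ≤ ℕ→ℚ n
  0≤ℕ→ℚ n = ℕ→ℚ-mono-≤ {0} {n} ℕ.z≤n

  ℕ→ℚ-≤-step : ∀ {m n c} → m ℕ.≤ n → 0ℚ ≤ c → ℕ→ℚ m ≤ ℕ→ℚ n + c
  ℕ→ℚ-≤-step {n = n} {c} m≤n 0≤c = ≤-trans (ℕ→ℚ-mono-≤ m≤n) (≤-by-gap {ℕ→ℚ n} c 0≤c refl)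

  archimedean : ∀ r → ∃[ N ] r < ℕ→ℚ N
  archimedean r@(mkℚ (+ k) d _) = suc k , subst (r <_) (sym (ℕ→ℚ≡mkℚ (suc k)))
    (*<* (subst₂ ℤ._<_ (sym (ℤ.*-identityʳ (+ k))) (ℤ.pos-* (suc k) (suc d))
                       (ℤ.+<+ (ℕ.m≤m*n (suc k) (suc d)))))
  archimedean r@(mkℚ -[1+ k ] _ _) = 0 , subst (r <_) (sym (ℕ→ℚ≡mkℚ 0))
    (*<* (subst (ℤ._< + 0) (sym (ℤ.*-identityʳ -[1+ k ])) ℤ.-<+))

  eventually-*inv-< : ∀ a {ε} → 0ℚ < ε → ∃[ N ] (∀ q (h : 0ℚ < q) → ℕ→ℚ N ≤ q → a * inv q h < ε)
  eventually-*inv-< a {ε} 0<ε with archimedean (a * inv ε 0<ε)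
  ... | N , a/ε<N = N , λ q h N≤q → <-*inv h (begin-strict
    a                    ≡⟨ inv-cancelˡ a ε 0<ε ⟨
    a * inv ε 0<ε * ε    <⟨ *-monoˡ-<-pos ε {{positive 0<ε}} a/ε<N ⟩
    ℕ→ℚ N * ε            ≤⟨ *-monoʳ-≤-nonNeg ε {{nonNegative (<⇒≤ 0<ε)}} N≤q ⟩
    q * ε                ≡⟨ *-comm q ε ⟩
    ε * q                ∎)
    where open ≤-Reasoning

  cube-gap : ∀ {a k b} → 0ℚ ≤ a → 0ℚ ≤ k → k * a ³ < b → ∃[ m ] (a < m × k * m ³ ≤ b)
  cube-gap {a} {k} {b} 0≤a 0≤k ka³<b = a + δ , <-by-gap δ 0<δ refl , k[a+δ]³≤b
    where
    g K : ℚ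
    g = b - k * a ³
    K = k * (ℕ→ℚ 3 * (a * a) + ℕ→ℚ 3 * a + 1ℚ)
    0<g : 0ℚ < g
    0<g = p<q⇒0<q-p ka³<b
    0≤K : 0ℚ ≤ K
    0≤K = 0≤p*q 0≤k
      (0≤p+q (0≤p+q (0≤p*q (0≤ℕ→ℚ 3) (0≤p*p a)) (0≤p*q (0≤ℕ→ℚ 3) 0≤a)) (<⇒≤ 0<1))
    0<K+g : 0ℚ < K + g
    0<K+g = 0<p+q 0≤K 0<g
    -- As δ = g/(K + g) ≤ 1, we get k (a + δ)³ - k a³ ≤ δ K = g - δ g.
    δ : ℚ
    δ = g * inv (K + g) 0<K+g
    0<δ : 0ℚ < δ
    0<δ = 0<p*q 0<g (inv-pos _ 0<K+g)
    δ≤1 : δ ≤ 1ℚ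
    δ≤1 = subst (δ ≤_) (inv-inverseʳ (K + g) 0<K+g)
      (*-monoʳ-≤-nonNeg (inv (K + g) 0<K+g) {{nonNegative (<⇒≤ (inv-pos _ 0<K+g))}}
        (≤-by-gap {g} K 0≤K (+-comm g K)))
    k[a+δ]³≤b : k * (a + δ) ³ ≤ b
    k[a+δ]³≤b = ≤-by-gap (δ * g + k * δ * (1ℚ - δ) * (ℕ→ℚ 3 * a + 1ℚ + δ))
      (0≤p+q (0≤p*q (<⇒≤ 0<δ) (<⇒≤ 0<g))
             (0≤p*q (0≤p*q (0≤p*q 0≤k (<⇒≤ 0<δ)) (p≤q⇒0≤q-p δ≤1))
                    (0≤p+q (0≤p+q (0≤p*q (0≤ℕ→ℚ 3) 0≤a) (<⇒≤ 0<1)) (<⇒≤ 0<δ))))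
      (≡-modulo 1ℚ (inv-cancelˡ g (K + g) 0<K+g)
        (solve 4 (λ a k b i →
          let g′ = b :- k :* (a :* a :* a)
              K′ = k :* (con (ℕ→ℚ 3) :* (a :* a) :+ con (ℕ→ℚ 3) :* a :+ con 1ℚ)
              δ′ = g′ :* i
          in k :* ((a :+ δ′) :* (a :+ δ′) :* (a :+ δ′))
               :+ (δ′ :* g′ :+ k :* δ′ :* (con 1ℚ :- δ′) :* (con (ℕ→ℚ 3) :* a :+ con 1ℚ :+ δ′))
             := b :+ con 1ℚ :* (δ′ :* (K′ :+ g′) :- g′))
          refl a k b (inv (K + g) 0<K+g)))

  27t≤4[t+1]³ : ∀ {t} → 0ℚ ≤ t → ℕ→ℚ 27 * t ≤ ℕ→ℚ 4 * (t + 1ℚ) ³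
  27t≤4[t+1]³ {t} 0≤t = ≤-by-gap ((ℕ→ℚ 2 * t - 1ℚ) * (ℕ→ℚ 2 * t - 1ℚ) * (t + ℕ→ℚ 4))
    (0≤p*q (0≤p*p (ℕ→ℚ 2 * t - 1ℚ)) (0≤p+q 0≤t (0≤ℕ→ℚ 4)))
    (solve 1 (λ t → let 2t-1 = con (ℕ→ℚ 2) :* t :- con 1ℚ in
                    con (ℕ→ℚ 27) :* t :+ 2t-1 :* 2t-1 :* (t :+ con (ℕ→ℚ 4))
                    := con (ℕ→ℚ 4) :* ((t :+ con 1ℚ) :* (t :+ con 1ℚ) :* (t :+ con 1ℚ)))
      refl t)

  am-gm : ∀ {m y z} → 0ℚ ≤ m → ℕ→ℚ 4 * m ³ ≤ ℕ→ℚ 27 → 0ℚ < y → 0ℚ ≤ z → y * z ≡ 1ℚ →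
          m ≤ y * y + z
  am-gm {m} {y} {z} 0≤m 4m³≤27 0<y 0≤z yz≡1 = begin
    m                  ≡⟨ ≡-modulo (- m) yz≡1
                            (solve 3 (λ m y z → m := m :* y :* z :+ (:- m) :* (y :* z :- con 1ℚ)) refl m y z) ⟩
    m * y * z          ≤⟨ *-monoʳ-≤-nonNeg z {{nonNegative 0≤z}} my≤y³+1 ⟩
    (y ³ + 1ℚ) * z     ≡⟨ ≡-modulo (y * y) yz≡1
                            (solve 2 (λ y z → (y :* y :* y :+ con 1ℚ) :* z
                                              := y :* y :+ z :+ y :* y :* (y :* z :- con 1ℚ)) refl y z) ⟩
    y * y + z          ∎
    where
    open ≤-Reasoning
    0≤y³ : 0ℚ ≤ y ³
    0≤y³ = 0≤p*q (0≤p*p y) (<⇒≤ 0<y)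
    my≤y³+1 : m * y ≤ y ³ + 1ℚ
    my≤y³+1 = cube-cancel-≤ (0≤p+q 0≤y³ (<⇒≤ 0<1)) (*-cancelˡ-≤-pos (ℕ→ℚ 4) (begin
      ℕ→ℚ 4 * (m * y) ³     ≡⟨ solve 2 (λ m y → con (ℕ→ℚ 4) :* ((m :* y) :* (m :* y) :* (m :* y))
                                            := con (ℕ→ℚ 4) :* (m :* m :* m) :* (y :* y :* y)) refl m y ⟩
      ℕ→ℚ 4 * m ³ * y ³     ≤⟨ *-monoʳ-≤-nonNeg (y ³) {{nonNegative 0≤y³}} 4m³≤27 ⟩
      ℕ→ℚ 27 * y ³          ≤⟨ 27t≤4[t+1]³ 0≤y³ ⟩
      ℕ→ℚ 4 * (y ³ + 1ℚ) ³  ∎))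

  shifted-square-≤ : ∀ x {e} → 0ℚ ≤ e → e ≤ 1ℚ →
                     (x + (1ℚ - x) * e) * (x + (1ℚ - x) * e) ≤ x * x + e
  shifted-square-≤ x {e} 0≤e e≤1 = ≤-by-gap (e * (x * x) + e * (1ℚ - e) * ((1ℚ - x) * (1ℚ - x)))
    (0≤p+q (0≤p*q 0≤e (0≤p*p x)) (0≤p*q (0≤p*q 0≤e (p≤q⇒0≤q-p e≤1)) (0≤p*p (1ℚ - x))))
    (solve 2 (λ x e → (x :+ (con 1ℚ :- x) :* e) :* (x :+ (con 1ℚ :- x) :* e)
                       :+ (e :* (x :* x) :+ e :* (con 1ℚ :- e) :* ((con 1ℚ :- x) :* (con 1ℚ :- x)))
                     := x :* x :+ e)
      refl x e)

  module Objective (Δ : ℕ) {x : ℚ} (0<x : 0ℚ < x) (x≤1 : x ≤ 1ℚ) where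
    D : ℚ
    D = ℕ→ℚ Δ

    0≤D : 0ℚ ≤ D
    0≤D = 0≤ℕ→ℚ Δ

    0<D+x : 0ℚ < D + x
    0<D+x = 0<p+q 0≤D 0<x

    0<xD+1 : 0ℚ < x * D + 1ℚ
    0<xD+1 = 0<p+q (0≤p*q (<⇒≤ 0<x) 0≤D) 0<1

    0<D+1 : 0ℚ < D + 1ℚ
    0<D+1 = 0<p+q 0≤D 0<1

    A B e y z : ℚ
    A = inv (D + x) 0<D+x
    B = inv (x * D + 1ℚ) 0<xD+1
    e = inv (D + 1ℚ) 0<D+1
    -- y = (xΔ + 1)/(Δ + 1), so that (Δ + 1)/(xΔ + 1) = z = 1/y.
    y = x + (1ℚ - x) * e
    z = (D + 1ℚ) * B

    0≤A : 0ℚ ≤ A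
    0≤A = <⇒≤ (inv-pos _ 0<D+x)

    0≤e : 0ℚ ≤ e
    0≤e = <⇒≤ (inv-pos _ 0<D+1)

    0≤z : 0ℚ ≤ z
    0≤z = 0≤p*q (<⇒≤ 0<D+1) (<⇒≤ (inv-pos _ 0<xD+1))

    0≤1-x : 0ℚ ≤ 1ℚ - x
    0≤1-x = p≤q⇒0≤q-p x≤1

    scaled-objective : (D + 1ℚ) * objective Δ x 0<x ≡ (D + 1ℚ) * (x * x * A) + z
    scaled-objective = *-distribˡ-+ (D + 1ℚ) (x * x * A) B

    x²≤[D+1]x²A : x * x ≤ (D + 1ℚ) * (x * x * A)
    x²≤[D+1]x²A = ≤-by-gap ((1ℚ - x) * (x * x) * A) (0≤p*q (0≤p*q 0≤1-x (0≤p*p x)) 0≤A)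
      (≡-modulo (- (x * x)) (inv-inverseˡ (D + x) 0<D+x)
        (solve 3 (λ x D a → x :* x :+ (con 1ℚ :- x) :* (x :* x) :* a
                            := (D :+ con 1ℚ) :* (x :* x :* a) :+ (:- (x :* x)) :* (a :* (D :+ x) :- con 1ℚ))
          refl x D A))

    [D+1]x²A≤x²+A : (D + 1ℚ) * (x * x * A) ≤ x * x + A
    [D+1]x²A≤x²+A = ≤-by-gap (A * ((1ℚ - x) * (1ℚ + x) + x ³))
      (0≤p*q 0≤A (0≤p+q (0≤p*q 0≤1-x (0≤p+q (<⇒≤ 0<1) (<⇒≤ 0<x))) (0≤p*q (0≤p*p x) (<⇒≤ 0<x))))
      (≡-modulo (x * x) (inv-inverseˡ (D + x) 0<D+x)
        (solve 3 (λ x D a → (D :+ con 1ℚ) :* (x :* x :* a)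
                              :+ a :* ((con 1ℚ :- x) :* (con 1ℚ :+ x) :+ x :* x :* x)
                            := x :* x :+ a :+ x :* x :* (a :* (D :+ x) :- con 1ℚ))
          refl x D A))

    0<y : 0ℚ < y
    0<y = 0<p+q′ 0<x (0≤p*q 0≤1-x 0≤e)

    x≤y : x ≤ y
    x≤y = ≤-by-gap ((1ℚ - x) * e) (0≤p*q 0≤1-x 0≤e) refl

    y*z≡1 : y * z ≡ 1ℚ
    y*z≡1 = trans
      (≡-modulo ((1ℚ - x) * B) (inv-inverseˡ (D + 1ℚ) 0<D+1)
        (solve 4 (λ x D e b → (x :+ (con 1ℚ :- x) :* e) :* ((D :+ con 1ℚ) :* b)
                              := b :* (x :* D :+ con 1ℚ)
                                 :+ (con 1ℚ :- x) :* b :* (e :* (D :+ con 1ℚ) :- con 1ℚ))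
          refl x D e B))
      (inv-inverseˡ (x * D + 1ℚ) 0<xD+1)

    x*z≤1 : x * z ≤ 1ℚ
    x*z≤1 = subst (x * z ≤_) y*z≡1 (*-monoʳ-≤-nonNeg z {{nonNegative 0≤z}} x≤y)

    y²≤x²+e : y * y ≤ x * x + e
    y²≤x²+e = shifted-square-≤ x 0≤e (inv≤1 0<D+1 (≤-by-gap {1ℚ} D 0≤D (+-comm 1ℚ D)))

    0≤scaled-objective : 0ℚ ≤ (D + 1ℚ) * objective Δ x 0<x
    0≤scaled-objective = subst (0ℚ ≤_) (sym scaled-objective)
      (0≤p+q (0≤p*q (<⇒≤ 0<D+1) (0≤p*q (0≤p*p x) 0≤A)) 0≤z)

    scaled-objective≤ : (D + 1ℚ) * objective Δ x 0<x ≤ x * x + A + z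
    scaled-objective≤ = subst (_≤ x * x + A + z) (sym scaled-objective) (+-monoˡ-≤ z [D+1]x²A≤x²+A)

    ≤scaled-objective : ∀ {m} → 0ℚ ≤ m → ℕ→ℚ 4 * m ³ ≤ ℕ→ℚ 27 →
                        m - e ≤ (D + 1ℚ) * objective Δ x 0<x
    ≤scaled-objective {m} 0≤m 4m³≤27 = begin
      m - e                            ≤⟨ +-monoˡ-≤ (- e) (am-gm 0≤m 4m³≤27 0<y 0≤z y*z≡1) ⟩
      y * y + z - e                    ≤⟨ +-monoˡ-≤ (- e) (+-monoˡ-≤ z y²≤x²+e) ⟩
      x * x + e + z - e                ≡⟨ solve 3 (λ x e z → x :+ e :+ z :- e := x :+ z) refl (x * x) e z ⟩
      x * x + z                        ≤⟨ +-monoˡ-≤ z x²≤[D+1]x²A ⟩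
      (D + 1ℚ) * (x * x * A) + z       ≡⟨ scaled-objective ⟨
      (D + 1ℚ) * objective Δ x 0<x     ∎
      where open ≤-Reasoning

  ratio-eventually-above : ∀ {p} → BelowLimitConst p → ∃[ N ] (∀ Δ → N ℕ.≤ Δ → RatioAbove Δ p)
  ratio-eventually-above {p} (inj₁ p≤0) = 0 , λ Δ _ → 1ℚ , 0<1 , ≤-refl , ≤-<-trans (p[D+1]f≤0 Δ) 0<1
    where
    p[D+1]f≤0 : ∀ Δ → p * (ℕ→ℚ Δ + 1ℚ) * objective Δ 1ℚ 0<1 ≤ 0ℚ
    p[D+1]f≤0 Δ = subst (_≤ 0ℚ) (sym (*-assoc p (ℕ→ℚ Δ + 1ℚ) (objective Δ 1ℚ 0<1)))
      (nonPositive⁻¹ _ {{nonPos*nonNeg⇒nonPos p {{nonPositive p≤0}} _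
                          {{nonNegative (Objective.0≤scaled-objective Δ 0<1 ≤-refl)}}}})
  ratio-eventually-above {p} (inj₂ (0<p , 27p³<4)) = N , λ Δ N≤Δ → x , 0<x , x≤1 , p[D+1]f<1 Δ N≤Δ
    where
    -- ε is the room left in 9p³/4 + 2/3 < 1, the value of p (x² + 1/x) at x = 3p/2.
    x ⅔ ε : ℚ
    x = p + p * ½
    ⅔ = + 2 / 3
    ε = (ℕ→ℚ 4 - ℕ→ℚ 27 * p ³) * (+ 1 / 12)

    0<x : 0ℚ < x
    0<x = 0<p+q′ 0<p (0≤p*q (<⇒≤ 0<p) (nonNegative⁻¹ ½))

    0<4-27p³ : 0ℚ < ℕ→ℚ 4 - ℕ→ℚ 27 * p ³
    0<4-27p³ = p<q⇒0<q-p 27p³<4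

    x≤1 : x ≤ 1ℚ
    x≤1 = cube-cancel-≤ (<⇒≤ 0<1)
      (≤-by-gap ((ℕ→ℚ 4 - ℕ→ℚ 27 * p ³) * (½ * ½ * ½) + ½)
        (0≤p+q (0≤p*q (<⇒≤ 0<4-27p³) (nonNegative⁻¹ _)) (nonNegative⁻¹ ½))
        (solve 1 (λ p → let x′ = p :+ p :* con ½ in
                    x′ :* x′ :* x′
                      :+ ((con (ℕ→ℚ 4) :- con (ℕ→ℚ 27) :* (p :* p :* p)) :* (con ½ :* con ½ :* con ½) :+ con ½)
                    := con 1ℚ)
          refl p))

    0<ε : 0ℚ < ε
    0<ε = 0<p*q 0<4-27p³ (positive⁻¹ _)

    N : ℕ
    N = proj₁ (eventually-*inv-< p 0<ε)

    p[D+1]f<1 : ∀ Δ → N ℕ.≤ Δ → p * (ℕ→ℚ Δ + 1ℚ) * objective Δ x 0<x < 1ℚ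
    p[D+1]f<1 Δ N≤Δ = begin-strict
      p * (D + 1ℚ) * objective Δ x 0<x    ≡⟨ *-assoc p (D + 1ℚ) (objective Δ x 0<x) ⟩
      p * ((D + 1ℚ) * objective Δ x 0<x)  ≤⟨ *-monoˡ-≤-nonNeg p {{nonNegative (<⇒≤ 0<p)}} scaled-objective≤ ⟩
      p * (x * x + A + z)                 ≡⟨ solve 4 (λ p x a z → p :* (x :+ a :+ z) := p :* x :+ p :* z :+ p :* a)
                                               refl p (x * x) A z ⟩
      p * (x * x) + p * z + p * A         <⟨ +-mono-≤-< (+-monoʳ-≤ (p * (x * x)) pz≤⅔) pA<ε ⟩
      p * (x * x) + ⅔ + ε                 ≡⟨ solve 1 (λ p → let x′ = p :+ p :* con ½ in
                                                 p :* (x′ :* x′) :+ con ⅔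
                                                   :+ (con (ℕ→ℚ 4) :- con (ℕ→ℚ 27) :* (p :* p :* p)) :* con (+ 1 / 12)
                                                 := con 1ℚ) refl p ⟩
      1ℚ                                  ∎
      where
      open ≤-Reasoning
      open Objective Δ 0<x x≤1
      pz≤⅔ : p * z ≤ ⅔
      pz≤⅔ = begin
        p * z        ≡⟨ solve 2 (λ p z → p :* z := con ⅔ :* ((p :+ p :* con ½) :* z)) refl p z ⟩
        ⅔ * (x * z)  ≤⟨ *-monoˡ-≤-nonNeg ⅔ x*z≤1 ⟩
        ⅔ * 1ℚ       ≡⟨ *-identityʳ ⅔ ⟩
        ⅔            ∎
      pA<ε : p * A < ε
      pA<ε = proj₂ (eventually-*inv-< p 0<ε) (D + x) 0<D+x (ℕ→ℚ-≤-step N≤Δ (<⇒≤ 0<x))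

  ratio-eventually-below : ∀ {q} → AboveLimitConst q → ∃[ N ] (∀ Δ → N ℕ.≤ Δ → RatioBelow Δ q)
  ratio-eventually-below {q} (0<q , 4<27q³) = N , λ Δ N≤Δ → r , r<q , 1≤r[D+1]f Δ N≤Δ
    where
    -- s = 1/q < 1/c ; m is a rational with s < m ≤ 1/c, T the midpoint of s and m, r = 1/T.
    s : ℚ
    s = inv q 0<q

    0<s : 0ℚ < s
    0<s = inv-pos q 0<q

    4s³<27 : ℕ→ℚ 4 * s ³ < ℕ→ℚ 27
    4s³<27 = *-cancelʳ-<-nonNeg (q ³) {{nonNegative (0≤p*q (0≤p*p q) (<⇒≤ 0<q))}}
      (subst (_< ℕ→ℚ 27 * q ³) (sym 4s³q³≡4) 4<27q³)
      where
      4s³q³≡4 : ℕ→ℚ 4 * s ³ * q ³ ≡ ℕ→ℚ 4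
      4s³q³≡4 = trans
        (solve 2 (λ s q → con (ℕ→ℚ 4) :* (s :* s :* s) :* (q :* q :* q)
                          := con (ℕ→ℚ 4) :* ((s :* q) :* (s :* q) :* (s :* q))) refl s q)
        (cong (λ t → ℕ→ℚ 4 * t ³) (inv-inverseˡ q 0<q))

    gap : ∃[ m ] (s < m × ℕ→ℚ 4 * m ³ ≤ ℕ→ℚ 27)
    gap = cube-gap (<⇒≤ 0<s) (0≤ℕ→ℚ 4) 4s³<27

    m : ℚ
    m = proj₁ gap

    s<m : s < m
    s<m = proj₁ (proj₂ gap)

    4m³≤27 : ℕ→ℚ 4 * m ³ ≤ ℕ→ℚ 27
    4m³≤27 = proj₂ (proj₂ gap)

    T δ : ℚ
    T = (s + m) * ½
    δ = (m - s) * ½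

    0<δ : 0ℚ < δ
    0<δ = 0<p*q (p<q⇒0<q-p s<m) (positive⁻¹ ½)

    s<T : s < T
    s<T = <-by-gap δ 0<δ (solve 2 (λ s m → s :+ (m :- s) :* con ½ := (s :+ m) :* con ½) refl s m)

    0<T : 0ℚ < T
    0<T = <-trans 0<s s<T

    r : ℚ
    r = inv T 0<T

    r<q : r < q
    r<q = subst (_< q) (*-identityˡ r)
      (<-*inv 0<T (subst (_< q * T) (inv-inverseʳ q 0<q) (*-monoʳ-<-pos q {{positive 0<q}} s<T)))

    N : ℕ
    N = proj₁ (eventually-*inv-< 1ℚ 0<δ)

    1≤r[D+1]f : ∀ Δ → N ℕ.≤ Δ → (x : ℚ) (h : 0ℚ < x) → x ≤ 1ℚ →
                1ℚ ≤ r * (ℕ→ℚ Δ + 1ℚ) * objective Δ x h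
    1≤r[D+1]f Δ N≤Δ x 0<x x≤1 = begin
      1ℚ                                  ≡⟨ inv-inverseˡ T 0<T ⟨
      r * T                               ≤⟨ *-monoˡ-≤-nonNeg r {{nonNegative (<⇒≤ (inv-pos T 0<T))}} T≤[D+1]f ⟩
      r * ((D + 1ℚ) * objective Δ x 0<x)  ≡⟨ *-assoc r (D + 1ℚ) (objective Δ x 0<x) ⟨
      r * (D + 1ℚ) * objective Δ x 0<x    ∎
      where
      open ≤-Reasoning
      open Objective Δ 0<x x≤1
      e<δ : e < δ
      e<δ = subst (_< δ) (*-identityˡ e)
        (proj₂ (eventually-*inv-< 1ℚ 0<δ) (D + 1ℚ) 0<D+1 (ℕ→ℚ-≤-step N≤Δ (<⇒≤ 0<1)))
      T≤[D+1]f : T ≤ (D + 1ℚ) * objective Δ x 0<x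
      T≤[D+1]f = ≤-trans
        (≤-by-gap (δ - e) (p≤q⇒0≤q-p (<⇒≤ e<δ))
          (solve 3 (λ s m e → (s :+ m) :* con ½ :+ ((m :- s) :* con ½ :- e) := m :- e) refl s m e))
        (≤scaled-objective (<⇒≤ (<-trans 0<s s<m)) 4m³≤27)

open import Data.Nat using (ℕ; _≤_)
import Data.Nat as ℕ
import Data.Nat.Properties as ℕ
open RatioAsymptotics using (ratio-eventually-above; ratio-eventually-below)

mainTheorem7 : (p q : ℚ) → BelowLimitConst p → AboveLimitConst q →
    ∃[ N ] ((Δ : ℕ) → 1 ≤ Δ → N ≤ Δ → RatioAbove Δ p × RatioBelow Δ q)
mainTheorem7 p q p<c c<q = N₁ ℕ.+ N₂ , λ Δ _ N≤Δ →
  above Δ (ℕ.≤-trans (ℕ.m≤m+n N₁ N₂) N≤Δ) , below Δ (ℕ.≤-trans (ℕ.m≤n+m N₂ N₁) N≤Δ)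
  where
  N₁ N₂ : ℕ
  N₁ = proj₁ (ratio-eventually-above p<c)
  N₂ = proj₁ (ratio-eventually-below c<q)
  above : ∀ Δ → N₁ ≤ Δ → RatioAbove Δ p
  above = proj₂ (ratio-eventually-above p<c)
  below : ∀ Δ → N₂ ≤ Δ → RatioBelow Δ q
  below = proj₂ (ratio-eventually-below c<q)
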